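{- Let $h, a, k$ be positive integers and $d$ an integer (not necessarily positive) such that $\gcd(a,d)=1$ and $a+kd>0$. Then $$\langle a\rangle + \langle ha+d\rangle + \langle ha+2d\rangle + \cdots + \langle ha+kd\rangle = \langle a\rangle \oplus \left\{ ha\left\lceil \frac{r}{k}\right\rceil + dr : 0\le r<a\right\}.$$
   Context: $\mathbb{N}$ = nonnegative integers; $\langle a\rangle := \{an : n\in\mathbb{N}\}$. For sets $A,B$ of integers, $A+B := \{x+y\}$, and $C = A\oplus B$ means $C=A+B$ with every element of $C$ having a unique representation $x+y$, $x\in A$, $y\in B$. -}

module Defs where

open import Level using (0ℓ)
open import Data.Nat as ℕ using (ℕ; zero; suc; NonZero)
open import Data.Nat.DivMod using (_/_)
open import Data.Integer using (ℤ; +_; _+_; _*_)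
open import Data.Product using (Σ; _×_; _,_; ∃)
open import Relation.Binary.PropositionalEquality using (_≡_)
open import Function.Bundles using (_⇔_)

ISet : Set₁
ISet = ℤ → Set

⟨_⟩ : ℤ → ISet
⟨ g ⟩ x = Σ ℕ λ n → x ≡ g * + n

_⊞_ : ISet → ISet → ISet
(A ⊞ B) z = Σ ℤ λ x → Σ ℤ λ y → A x × B y × z ≡ x + y

_≐_ : ISet → ISet → Set
C ≐ D = ∀ z → (C z ⇔ D z)

IsDirectSum : ISet → ISet → ISet → Set
IsDirectSum C A B =
  (C ≐ (A ⊞ B)) ×
  (∀ z → C z → ∀ x₁ y₁ x₂ y₂ → A x₁ → B y₁ → A x₂ → B y₂ →
     z ≡ x₁ + y₁ → z ≡ x₂ + y₂ → (x₁ ≡ x₂) × (y₁ ≡ y₂))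

⌈_/_⌉ : ℕ → (k : ℕ) → .{{NonZero k}} → ℕ
⌈ r / k ⌉ = (r ℕ.+ k ℕ.∸ 1) / k

LHS : ℤ → ℤ → ℤ → ℕ → ISet
LHS a h d zero    = ⟨ a ⟩
LHS a h d (suc i) = LHS a h d i ⊞ ⟨ h * a + + (suc i) * d ⟩

RSet : ℕ → ℕ → ℤ → (k : ℕ) → .{{NonZero k}} → ISet
RSet a h d k x = Σ ℕ λ r → (r ℕ.< a) × (x ≡ + h * + a * + ⌈ r / k ⌉ + d * + r)

-- An element of ⟨a⟩ + ⟨ha+d⟩ + ⋯ + ⟨ha+kd⟩ is a n + h a m + d r, where m counts the chosen
-- summands ha + jd and r is the sum of their indices j; exactly the pairs with m ≤ r ≤ k m occur.
-- Writing r = r₀ + q a with r₀ < a and lowering m to ⌈r₀/k⌉ changes the value by a multiple of a,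
-- which is nonnegative because a + k d > 0 and h ≥ 1: this gives the sum. Uniqueness holds because
-- two representations with residues r₁, r₂ < a force a ∣ d (r₁ − r₂), hence r₁ = r₂ as gcd(a,d) = 1.
module Submission where

open import Defs
open import Data.Integer as ℤ using (ℤ; +_; -[1+_]; 0ℤ; _+_; _*_; -_; _-_; ∣_∣)
import Data.Integer.Properties as ℤ
open import Data.Integer.GCD using (gcd)
import Data.Integer.Tactic.RingSolver as ℤ-Ring
open import Data.Nat as ℕ using (ℕ; zero; suc; _≤_; _<_; z≤n; s≤s; s≤s⁻¹; NonZero)
open import Data.Nat.Coprimality using (Coprime; coprime-divisor; gcd≡1⇒coprime)
open import Data.Nat.Divisibility using (divides; n∣m*n; n∣m⇒m%n≡0)
open import Data.Nat.DivMod using (_/_; _%_; m≡m%n+[m/n]*n; m%n<n; m<n⇒m%n≡m; m<n*o⇒m/o<n; +-distrib-/-∣ʳ; m*n/n≡m)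
open import Data.Nat.Properties
import Data.Nat.Tactic.RingSolver as ℕ-Ring
open import Data.Product using (Σ; _×_; _,_)
open import Data.Sum using (inj₁; inj₂)
open import Function.Bundles using (mk⇔)
open import Relation.Binary.PropositionalEquality
open import Relation.Nullary using (yes; no; contradiction)

open import Algebra.Properties.AbelianGroup ℤ.+-0-abelianGroup using (∙-cancelˡ; ∙-cancelʳ)
open import Algebra.Properties.CommutativeSemigroup *-commutativeSemigroup using (x∙yz≈y∙xz)

⌈/⌉-unfold : ∀ r k → ⌈ r / suc k ⌉ ≡ (r ℕ.+ k) / suc k
⌈/⌉-unfold r k = cong (λ x → (x ℕ.∸ 1) / suc k) (+-suc r k)

m≤n*⌈m/n⌉ : ∀ r k → r ≤ suc k ℕ.* ⌈ r / suc k ⌉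
m≤n*⌈m/n⌉ r k = begin
  r                         ≤⟨ +-cancelʳ-≤ k r (q ℕ.* suc k) r+k≤ ⟩
  q ℕ.* suc k               ≡⟨ *-comm q (suc k) ⟩
  suc k ℕ.* q               ≡⟨ cong (suc k ℕ.*_) (⌈/⌉-unfold r k) ⟨
  suc k ℕ.* ⌈ r / suc k ⌉   ∎
  where
  open ≤-Reasoning
  q : ℕ
  q = (r ℕ.+ k) / suc k
  r+k≤ : r ℕ.+ k ≤ q ℕ.* suc k ℕ.+ k
  r+k≤ = begin
    r ℕ.+ k                          ≡⟨ m≡m%n+[m/n]*n (r ℕ.+ k) (suc k) ⟩
    (r ℕ.+ k) % suc k ℕ.+ q ℕ.* suc k ≤⟨ +-monoˡ-≤ (q ℕ.* suc k) (s≤s⁻¹ (m%n<n (r ℕ.+ k) (suc k))) ⟩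
    k ℕ.+ q ℕ.* suc k                ≡⟨ +-comm k (q ℕ.* suc k) ⟩
    q ℕ.* suc k ℕ.+ k                ∎

⌈m/n⌉≤o : ∀ {r m} k → r ≤ suc k ℕ.* m → ⌈ r / suc k ⌉ ≤ m
⌈m/n⌉≤o {r} {m} k r≤km = s≤s⁻¹ (begin-strict
  ⌈ r / suc k ⌉        ≡⟨ ⌈/⌉-unfold r k ⟩
  (r ℕ.+ k) / suc k    <⟨ m<n*o⇒m/o<n (s≤s r+k≤) ⟩
  suc m                ∎)
  where
  open ≤-Reasoning
  r+k≤ : r ℕ.+ k ≤ k ℕ.+ m ℕ.* suc k
  r+k≤ = begin
    r ℕ.+ k              ≤⟨ +-monoˡ-≤ k r≤km ⟩
    suc k ℕ.* m ℕ.+ k    ≡⟨ cong (ℕ._+ k) (*-comm (suc k) m) ⟩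
    m ℕ.* suc k ℕ.+ k    ≡⟨ +-comm (m ℕ.* suc k) k ⟩
    k ℕ.+ m ℕ.* suc k    ∎

⌈/⌉-monoˡ-≤ : ∀ {x y} k → x ≤ y → ⌈ x / suc k ⌉ ≤ ⌈ y / suc k ⌉
⌈/⌉-monoˡ-≤ {y = y} k x≤y = ⌈m/n⌉≤o k (≤-trans x≤y (m≤n*⌈m/n⌉ y k))

⌈m/n⌉≤m : ∀ r k → ⌈ r / suc k ⌉ ≤ r
⌈m/n⌉≤m r k = ⌈m/n⌉≤o k (m≤n*m r (suc k))

⌈[m+n*o]/n⌉≡⌈m/n⌉+o : ∀ x k y → ⌈ x ℕ.+ suc k ℕ.* y / suc k ⌉ ≡ ⌈ x / suc k ⌉ ℕ.+ y
⌈[m+n*o]/n⌉≡⌈m/n⌉+o x k y = begin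
  ⌈ x ℕ.+ suc k ℕ.* y / suc k ⌉              ≡⟨ ⌈/⌉-unfold (x ℕ.+ suc k ℕ.* y) k ⟩
  (x ℕ.+ suc k ℕ.* y ℕ.+ k) / suc k          ≡⟨ cong (_/ suc k) (shuffle x y k) ⟩
  ((x ℕ.+ k) ℕ.+ y ℕ.* suc k) / suc k        ≡⟨ +-distrib-/-∣ʳ (x ℕ.+ k) (n∣m*n y) ⟩
  (x ℕ.+ k) / suc k ℕ.+ y ℕ.* suc k / suc k  ≡⟨ cong₂ ℕ._+_ (sym (⌈/⌉-unfold x k)) (m*n/n≡m y (suc k)) ⟩
  ⌈ x / suc k ⌉ ℕ.+ y                         ∎
  where
  open ≡-Reasoning
  shuffle : ∀ x y k → x ℕ.+ suc k ℕ.* y ℕ.+ k ≡ (x ℕ.+ k) ℕ.+ y ℕ.* suc k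
  shuffle = ℕ-Ring.solve-∀

split-part : ∀ i {m r} .{{_ : NonZero i}} → suc m ≤ r → r ≤ i ℕ.* suc m →
             Σ ℕ λ j → Σ ℕ λ r′ → 1 ≤ j × j ≤ i × r ≡ j ℕ.+ r′ × m ≤ r′ × r′ ≤ i ℕ.* m
split-part i {m} {r} m<r r≤ with r ℕ.∸ m ≤? i
... | yes r∸m≤i = r ℕ.∸ m , m , m<n⇒0<n∸m m<r , r∸m≤i , sym (m∸n+n≡m (<⇒≤ m<r)) , ≤-refl , m≤n*m m i
... | no r∸m≰i = i , r ℕ.∸ i , ℕ.>-nonZero⁻¹ i , ≤-refl , sym (m+[n∸m]≡n i≤r) , m≤r∸i ,
                 m≤n+o⇒m∸n≤o r i (≤-trans r≤ (≤-reflexive (*-suc i m)))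
  where
  m+i≤r : m ℕ.+ i ≤ r
  m+i≤r = ≤-trans (≤-reflexive (+-comm m i)) (<⇒≤ (m≤o∸n⇒m+n≤o (suc i) (<⇒≤ m<r) (≰⇒> r∸m≰i)))
  i≤r : i ≤ r
  i≤r = m+n≤o⇒n≤o m m+i≤r
  m≤r∸i : m ≤ r ℕ.∸ i
  m≤r∸i = m+n≤o⇒m≤o∸n m m+i≤r

module Sumset (a h d : ℤ) where

  generator : ℕ → ℤ
  generator j = h * a + + j * d

  combination : ℕ → ℕ → ℕ → ℤ
  combination n m r = a * + n + (h * a * + m + d * + r)

  combination-+-generator* : ∀ n m r j c →
    combination n m r + generator j * + c ≡ combination n (m ℕ.+ c) (r ℕ.+ j ℕ.* c)
  combination-+-generator* n m r j c = begin
    combination n m r + generator j * + c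
      ≡⟨ ring a h d (+ n) (+ m) (+ r) (+ j) (+ c) ⟩
    a * + n + (h * a * (+ m + + c) + d * (+ r + + j * + c))
      ≡⟨ cong (λ x → a * + n + (h * a * + (m ℕ.+ c) + d * (+ r + x))) (ℤ.pos-* j c) ⟨
    combination n (m ℕ.+ c) (r ℕ.+ j ℕ.* c) ∎
    where
    open ≡-Reasoning
    ring : ∀ A H D N M R J C →
      A * N + (H * A * M + D * R) + (H * A + J * D) * C ≡ A * N + (H * A * (M + C) + D * (R + J * C))
    ring = ℤ-Ring.solve-∀

  combination-suc : ∀ n m r j → combination n (suc m) (j ℕ.+ r) ≡ combination n m r + generator j
  combination-suc n m r j = ring a h d (+ n) (+ m) (+ r) (+ j)
    where
    ring : ∀ A H D N M R J →
      A * N + (H * A * (+ 1 + M) + D * (J + R)) ≡ A * N + (H * A * M + D * R) + (H * A + J * D)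
    ring = ℤ-Ring.solve-∀

  combination-zero : ∀ n → combination n 0 0 ≡ a * + n
  combination-zero n = ring a h d (+ n)
    where
    ring : ∀ A H D N → A * N + (H * A * + 0 + D * + 0) ≡ A * N
    ring = ℤ-Ring.solve-∀

  multiple∈LHS : ∀ i n → LHS a h d i (a * + n)
  multiple∈LHS zero    n = n , refl
  multiple∈LHS (suc i) n =
    a * + n , 0ℤ , multiple∈LHS i n , (0 , sym (ℤ.*-zeroʳ (generator (suc i)))) , sym (ℤ.+-identityʳ _)

  LHS-+-generator : ∀ i {j z} → 1 ≤ j → j ≤ i → LHS a h d i z → LHS a h d i (z + generator j)
  LHS-+-generator zero    1≤j j≤0 = contradiction (≤-trans 1≤j j≤0) λ ()
  LHS-+-generator (suc i) {j} 1≤j j≤1+i (x , y , x∈ , (c , y≡) , z≡) with j ℕ.≟ suc i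
  ... | yes refl = x , y + generator j , x∈ , (suc c , y+g≡) , trans (cong (_+ generator j) z≡) (ℤ.+-assoc x y _)
    where
    y+g≡ : y + generator j ≡ generator j * + suc c
    y+g≡ = trans (cong (_+ generator j) y≡) (ring (generator j) (+ c))
      where
      ring : ∀ G C → G * C + G ≡ G * (+ 1 + C)
      ring = ℤ-Ring.solve-∀
  ... | no j≢1+i = x + generator j , y , LHS-+-generator i 1≤j (s≤s⁻¹ (≤∧≢⇒< j≤1+i j≢1+i)) x∈ , (c , y≡) ,
                   trans (cong (_+ generator j) z≡) (ring x y (generator j))
    where
    ring : ∀ x y g → x + y + g ≡ x + g + y
    ring = ℤ-Ring.solve-∀

  LHS⇒combination : ∀ i {z} → LHS a h d i z →
    Σ ℕ λ n → Σ ℕ λ m → Σ ℕ λ r → m ≤ r × r ≤ i ℕ.* m × z ≡ combination n m r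
  LHS⇒combination zero (n , z≡) = n , 0 , 0 , z≤n , z≤n , trans z≡ (sym (combination-zero n))
  LHS⇒combination (suc i) (x , y , x∈ , (c , y≡) , z≡) with LHS⇒combination i x∈
  ... | n , m , r , m≤r , r≤im , x≡ =
    n , m ℕ.+ c , r ℕ.+ suc i ℕ.* c ,
    +-mono-≤ m≤r (m≤n*m c (suc i)) ,
    ≤-trans (+-monoˡ-≤ (suc i ℕ.* c) (≤-trans r≤im (*-monoˡ-≤ m (n≤1+n i))))
            (≤-reflexive (sym (*-distribˡ-+ (suc i) m c))) ,
    trans z≡ (trans (cong₂ _+_ x≡ y≡) (combination-+-generator* n m r (suc i) c))

  combination∈LHS : ∀ i .{{_ : NonZero i}} n {m r} → m ≤ r → r ≤ i ℕ.* m → LHS a h d i (combination n m r)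
  combination∈LHS i n {zero} {r} _ r≤0 rewrite n≤0⇒n≡0 (≤-trans r≤0 (≤-reflexive (*-zeroʳ i))) =
    subst (LHS a h d i) (sym (combination-zero n)) (multiple∈LHS i n)
  combination∈LHS i n {suc m} m<r r≤ with split-part i m<r r≤
  ... | j , r′ , 1≤j , j≤i , refl , m≤r′ , r′≤im =
    subst (LHS a h d i) (sym (combination-suc n m r′ j))
      (LHS-+-generator i 1≤j j≤i (combination∈LHS i n m≤r′ r′≤im))

0<m-n⇒n≤m : ∀ m n → 0ℤ ℤ.< + m - + n → n ≤ m
0<m-n⇒n≤m m n 0<m-n with n ≤? m
... | yes n≤m = n≤m
... | no n≰m = contradiction (subst (ℤ._≤ 0ℤ) (sym m-n≡) ℤ.neg-≤-pos) (ℤ.<⇒≱ 0<m-n)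
  where
  m-n≡ : + m - + n ≡ - + (n ℕ.∸ m)
  m-n≡ = trans (ℤ.m-n≡m⊖n m n) (ℤ.⊖-≰ n≰m)

negative-part : ∀ h a k d → 0 < h → 0ℤ ℤ.< + a + + k * d →
  Σ ℕ λ e → Σ ℕ λ w → k ℕ.* e ≤ a × + h * + e + d ≡ + w
negative-part h a k (+ d) _ _ =
  0 , d , subst (_≤ a) (sym (*-zeroʳ k)) z≤n , cong (_+ + d) (ℤ.*-zeroʳ (+ h))
negative-part (suc h) a k -[1+ e ] _ 0<a+kd =
  suc e , h ℕ.* suc e , 0<m-n⇒n≤m a (k ℕ.* suc e) (subst (0ℤ ℤ.<_) a+kd≡ 0<a+kd) ,
  trans (ring (+ h) (+ suc e)) (sym (ℤ.pos-* h (suc e)))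
  where
  a+kd≡ : + a + + k * -[1+ e ] ≡ + a - + (k ℕ.* suc e)
  a+kd≡ = cong (_+_ (+ a)) (trans (sym (ℤ.neg-distribʳ-* (+ k) (+ suc e))) (cong -_ (sym (ℤ.pos-* k (suc e)))))
  ring : ∀ H E → (+ 1 + H) * E + - E ≡ H * E
  ring = ℤ-Ring.solve-∀

module Reduction (a h : ℕ) (d : ℤ) where
  open Sumset (+ a) (+ h) d

  combination-reduce : ∀ n c t r₀ q {e w} → + h * + e + d ≡ + w →
    combination n (c ℕ.+ q ℕ.* e ℕ.+ t) (r₀ ℕ.+ q ℕ.* a) ≡ combination (n ℕ.+ h ℕ.* t ℕ.+ q ℕ.* w) c r₀
  combination-reduce n c t r₀ q {e} {w} he+d≡w = begin
    combination n (c ℕ.+ q ℕ.* e ℕ.+ t) (r₀ ℕ.+ q ℕ.* a)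
      ≡⟨ cong₂ (λ u v → + a * + n + (+ h * + a * (+ c + u + + t) + d * (+ r₀ + v))) (ℤ.pos-* q e) (ℤ.pos-* q a) ⟩
    + a * + n + (+ h * + a * (+ c + + q * + e + + t) + d * (+ r₀ + + q * + a))
      ≡⟨ ring (+ a) (+ h) d (+ n) (+ c) (+ t) (+ r₀) (+ q) (+ e) ⟩
    + a * (+ n + + h * + t + + q * (+ h * + e + d)) + (+ h * + a * + c + d * + r₀)
      ≡⟨ cong (λ x → + a * (+ n + + h * + t + + q * x) + (+ h * + a * + c + d * + r₀)) he+d≡w ⟩
    + a * (+ n + + h * + t + + q * + w) + (+ h * + a * + c + d * + r₀)
      ≡⟨ cong₂ (λ u v → + a * (+ n + u + v) + (+ h * + a * + c + d * + r₀)) (ℤ.pos-* h t) (ℤ.pos-* q w) ⟨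
    combination (n ℕ.+ h ℕ.* t ℕ.+ q ℕ.* w) c r₀ ∎
    where
    open ≡-Reasoning
    ring : ∀ A H D N C T R₀ Q E →
      A * N + (H * A * (C + Q * E + T) + D * (R₀ + Q * A)) ≡ A * (N + H * T + Q * (H * E + D)) + (H * A * C + D * R₀)
    ring = ℤ-Ring.solve-∀

  -- When d < 0, lowering m by q e (e is the negative part of d) pays for removing q a from r;
  -- what is left is the multiple q w of a with w = h e + d ≥ 0, absorbed into ⟨a⟩.
  reduce : ∀ k .{{_ : NonZero a}} {e w} → suc k ℕ.* e ≤ a → + h * + e + d ≡ + w →
    ∀ n {m r} → r ≤ suc k ℕ.* m →
    Σ ℕ λ n′ → Σ ℕ λ r₀ → r₀ < a × combination n m r ≡ combination n′ ⌈ r₀ / suc k ⌉ r₀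
  reduce k {e} {w} ke≤a he+d≡w n {m} {r} r≤km with m≤n⇒∃[o]m+o≡n c+qe≤m
    where
    r₀ q : ℕ
    r₀ = r % a
    q = r / a
    r≡ : r ≡ r₀ ℕ.+ q ℕ.* a
    r≡ = m≡m%n+[m/n]*n r a
    kqe≤qa : suc k ℕ.* (q ℕ.* e) ≤ q ℕ.* a
    kqe≤qa = ≤-trans (≤-reflexive (x∙yz≈y∙xz (suc k) q e)) (*-monoʳ-≤ q ke≤a)
    c+qe≤m : ⌈ r₀ / suc k ⌉ ℕ.+ q ℕ.* e ≤ m
    c+qe≤m = begin
      ⌈ r₀ / suc k ⌉ ℕ.+ q ℕ.* e               ≡⟨ ⌈[m+n*o]/n⌉≡⌈m/n⌉+o r₀ k (q ℕ.* e) ⟨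
      ⌈ r₀ ℕ.+ suc k ℕ.* (q ℕ.* e) / suc k ⌉   ≤⟨ ⌈/⌉-monoˡ-≤ k (+-monoʳ-≤ r₀ kqe≤qa) ⟩
      ⌈ r₀ ℕ.+ q ℕ.* a / suc k ⌉               ≡⟨ cong ⌈_/ suc k ⌉ r≡ ⟨
      ⌈ r / suc k ⌉                            ≤⟨ ⌈m/n⌉≤o k r≤km ⟩
      m                                        ∎
      where open ≤-Reasoning
  ... | t , refl = n ℕ.+ h ℕ.* t ℕ.+ r / a ℕ.* w , r % a , m%n<n r a ,
    trans (cong (combination n _) (m≡m%n+[m/n]*n r a)) (combination-reduce n _ t (r % a) (r / a) he+d≡w)

coprime-multiple⇒≡0 : ∀ {a s} .{{_ : NonZero a}} {d w} → Coprime a ∣ d ∣ → s < a → d * + s ≡ + a * w → s ≡ 0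
coprime-multiple⇒≡0 {a} {s} {d} {w} coprime s<a ds≡aw = begin
  s       ≡⟨ m<n⇒m%n≡m s<a ⟨
  s % a   ≡⟨ n∣m⇒m%n≡0 s a (coprime-divisor coprime (divides ∣ w ∣ ∣d∣s≡∣w∣a)) ⟩
  0       ∎
  where
  open ≡-Reasoning
  ∣d∣s≡∣w∣a : ∣ d ∣ ℕ.* s ≡ ∣ w ∣ ℕ.* a
  ∣d∣s≡∣w∣a = begin
    ∣ d ∣ ℕ.* s    ≡⟨ ℤ.abs-* d (+ s) ⟨
    ∣ d * + s ∣    ≡⟨ cong ∣_∣ ds≡aw ⟩
    ∣ + a * w ∣    ≡⟨ ℤ.abs-* (+ a) w ⟩
    a ℕ.* ∣ w ∣    ≡⟨ *-comm a ∣ w ∣ ⟩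
    ∣ w ∣ ℕ.* a    ∎

module Uniqueness (a h : ℕ) (d : ℤ) .{{_ : NonZero a}} (coprime : Coprime a ∣ d ∣) where
  open Sumset (+ a) (+ h) d

  residue-unique-≤ : ∀ {n₁ n₂ m₁ m₂ r₁ r₂} → r₁ ≤ r₂ → r₂ < a →
    combination n₁ m₁ r₁ ≡ combination n₂ m₂ r₂ → r₁ ≡ r₂
  residue-unique-≤ {n₁} {n₂} {m₁} {m₂} {r₁} r₁≤r₂ r₂<a eq with m≤n⇒∃[o]m+o≡n r₁≤r₂
  ... | s , refl = sym (trans (cong (r₁ ℕ.+_) s≡0) (+-identityʳ r₁))
    where
    ds≡aw : d * + s ≡ + a * ((+ n₁ + + h * + m₁) - (+ n₂ + + h * + m₂))
    ds≡aw = ∙-cancelˡ (combination n₂ m₂ r₁) _ _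
      (trans (sym (ring₁ (+ a) (+ h) d (+ n₂) (+ m₂) (+ r₁) (+ s)))
        (trans (sym eq) (ring₂ (+ a) (+ h) d (+ n₁) (+ n₂) (+ m₁) (+ m₂) (+ r₁))))
      where
      ring₁ : ∀ A H D N M R S → A * N + (H * A * M + D * (R + S)) ≡ A * N + (H * A * M + D * R) + D * S
      ring₁ = ℤ-Ring.solve-∀
      ring₂ : ∀ A H D N₁ N₂ M₁ M₂ R →
        A * N₁ + (H * A * M₁ + D * R) ≡ A * N₂ + (H * A * M₂ + D * R) + A * ((N₁ + H * M₁) - (N₂ + H * M₂))
      ring₂ = ℤ-Ring.solve-∀
    s≡0 : s ≡ 0
    s≡0 = coprime-multiple⇒≡0 {d = d} coprime (≤-<-trans (m≤n+m s r₁) r₂<a) ds≡aw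

  residue-unique : ∀ {n₁ n₂ m₁ m₂ r₁ r₂} → r₁ < a → r₂ < a →
    combination n₁ m₁ r₁ ≡ combination n₂ m₂ r₂ → r₁ ≡ r₂
  residue-unique {r₁ = r₁} {r₂} r₁<a r₂<a eq with ≤-total r₁ r₂
  ... | inj₁ r₁≤r₂ = residue-unique-≤ r₁≤r₂ r₂<a eq
  ... | inj₂ r₂≤r₁ = sym (residue-unique-≤ r₂≤r₁ r₁<a (sym eq))

LHS⊆⟨a⟩⊞RSet : ∀ a h k d .{{_ : NonZero a}} → 0 < h → 0ℤ ℤ.< + a + + suc k * d →
  ∀ {z} → LHS (+ a) (+ h) d (suc k) z → (⟨ + a ⟩ ⊞ RSet a h d (suc k)) z
LHS⊆⟨a⟩⊞RSet a h k d 0<h 0<a+kd z∈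
  with Sumset.LHS⇒combination (+ a) (+ h) d (suc k) z∈ | negative-part h a (suc k) d 0<h 0<a+kd
... | n , m , r , _ , r≤km , z≡ | e , w , ke≤a , he+d≡w
  with Reduction.reduce a h d k ke≤a he+d≡w n r≤km
...   | n′ , r₀ , r₀<a , reduced = + a * + n′ , _ , (n′ , refl) , (r₀ , r₀<a , refl) , trans z≡ reduced

⟨a⟩⊞RSet⊆LHS : ∀ a h k d {z} → (⟨ + a ⟩ ⊞ RSet a h d (suc k)) z → LHS (+ a) (+ h) d (suc k) z
⟨a⟩⊞RSet⊆LHS a h k d (_ , _ , (n , refl) , (r , _ , refl) , refl) =
  Sumset.combination∈LHS (+ a) (+ h) d (suc k) n (⌈m/n⌉≤m r k) (m≤n*⌈m/n⌉ r k)

⟨a⟩⊞RSet-unique : ∀ a h k d .{{_ : NonZero a}} .{{_ : NonZero k}} → Coprime a ∣ d ∣ →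
  ∀ {x₁ y₁ x₂ y₂} → ⟨ + a ⟩ x₁ → RSet a h d k y₁ → ⟨ + a ⟩ x₂ → RSet a h d k y₂ →
  x₁ + y₁ ≡ x₂ + y₂ → x₁ ≡ x₂ × y₁ ≡ y₂
⟨a⟩⊞RSet-unique a h k d coprime (_ , refl) (r₁ , r₁<a , refl) (_ , refl) (_ , r₂<a , refl) eq
  with Uniqueness.residue-unique a h d coprime r₁<a r₂<a eq
... | refl = ∙-cancelʳ _ _ _ eq , refl

corollary4p4 : (h a k : ℕ) (d : ℤ) → 0 < h → 0 < a → .{{_ : NonZero k}} →
    gcd (+ a) d ≡ + 1 → ℤ.0ℤ ℤ.< + a ℤ.+ + k ℤ.* d →
    IsDirectSum (LHS (+ a) (+ h) d k) ⟨ + a ⟩ (RSet a h d k)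
corollary4p4 h a (suc k) d 0<h 0<a gcd≡1 0<a+kd =
  (λ z → mk⇔ (LHS⊆⟨a⟩⊞RSet a h k d 0<h 0<a+kd) (⟨a⟩⊞RSet⊆LHS a h k d)) ,
  λ _ _ _ _ _ _ x₁∈ y₁∈ x₂∈ y₂∈ z≡₁ z≡₂ →
    ⟨a⟩⊞RSet-unique a h (suc k) d coprime x₁∈ y₁∈ x₂∈ y₂∈ (trans (sym z≡₁) z≡₂)
  where
  instance
    a-nonZero : NonZero a
    a-nonZero = ℕ.>-nonZero 0<a
  coprime : Coprime a ∣ d ∣
  coprime = gcd≡1⇒coprime (ℤ.+-injective gcd≡1)
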